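{- Let $d,D$ be integers with $2\le d\le D$ and $D\ge 3$. For $k\ge 1$ let $T_k$ be the complete rooted $(D-1)$-ary tree of depth $k$ (every non-leaf vertex has exactly $D-1$ children and all leaves are at depth $k$), with $n=n_k$ vertices and every edge of weight $1$, and let $G_k$ be the complete graph on the vertices of $T_k$ in which the weight of each edge $\{u,v\}$ is the number of edges on the $u$–$v$ path in $T_k$. Then there is a function $\varepsilon(n)$ (depending on $d$ and $D$) with $\varepsilon(n)\to 0$ as $n\to\infty$ such that every spanning tree $T'$ of $G_k$ with maximum degree at most $d$ has weight at least $$w(T_k)\cdot\left(2-\frac{d-2}{D-2}-\varepsilon(n)\right).$$
   Context: The weight of a tree is the sum of the weights of its edges; here $w(T_k)=n-1$. -}

module Defs where

open import Data.Nat using (ℕ; zero; suc; _+_; _*_; _∸_; _≤_; s≤s)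
open import Data.Fin using (Fin; _≟_)
open import Data.List using (List; []; _∷_; length; map; concatMap; allFin; _++_)
open import Data.Nat.ListAction using (sum)
open import Data.List.Properties using (≡-dec)
open import Data.List.Membership.Propositional using (_∈_)
open import Data.List.Relation.Unary.All using (All)
open import Data.List.Relation.Unary.AllPairs using (AllPairs)
open import Data.Product using (_×_; _,_)
open import Data.Sum using (_⊎_)
open import Data.Integer using (+_)
open import Data.Rational using (ℚ; _/_)
open import Relation.Nullary using (¬_; yes; no)
open import Relation.Binary.PropositionalEquality using (_≡_; _≢_)
open import Relation.Binary.Construct.Closure.ReflexiveTransitive using (Star)

-- A vertex of the complete rooted m-ary tree T_k (m = D-1) is the word of
-- child indices read from the root; the root is [], and the vertices are the
-- words of length ≤ k (a word of length i is a vertex at depth i).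
Word : ℕ → Set
Word m = List (Fin m)

wordsOfLen : (m i : ℕ) → List (Word m)
wordsOfLen m zero = [] ∷ []
wordsOfLen m (suc i) = concatMap (λ w → map (λ x → x ∷ w) (allFin m)) (wordsOfLen m i)

vertices : (m k : ℕ) → List (Word m)
vertices m zero = wordsOfLen m zero
vertices m (suc k) = vertices m k ++ wordsOfLen m (suc k)

numVertices : (m k : ℕ) → ℕ
numVertices m k = length (vertices m k)

-- length of the longest common prefix (= depth of the lowest common ancestor)
lcpLen : {m : ℕ} → Word m → Word m → ℕ
lcpLen [] _ = 0
lcpLen (_ ∷ _) [] = 0
lcpLen (x ∷ xs) (y ∷ ys) with x ≟ y
... | yes _ = suc (lcpLen xs ys)
... | no _ = 0

-- number of edges on the u–v path in T_k  (= weight of edge {u,v} in G_k)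
treeDist : {m : ℕ} → Word m → Word m → ℕ
treeDist u v = (length u + length v) ∸ 2 * lcpLen u v

Edge : ℕ → Set
Edge m = Word m × Word m

SameEdge : {m : ℕ} → Edge m → Edge m → Set
SameEdge (a , b) (c , d) = (a ≡ c × b ≡ d) ⊎ (a ≡ d × b ≡ c)

Adj : {m : ℕ} → List (Edge m) → Word m → Word m → Set
Adj E u v = ((u , v) ∈ E) ⊎ ((v , u) ∈ E)

-- A spanning tree of G_k (complete graph on the vertices of T_k):
-- a set of distinct edges between distinct vertices of T_k which is
-- connected and has exactly n-1 edges (i.e. a connected spanning subgraph
-- with n-1 edges, which is a tree).
record SpanningTree (m k : ℕ) : Set where
  field
    edges     : List (Edge m)
    inVertex  : All (λ e → (length (Data.Product.proj₁ e) ≤ k) × (length (Data.Product.proj₂ e) ≤ k)) edges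
    noLoops   : All (λ e → Data.Product.proj₁ e ≢ Data.Product.proj₂ e) edges
    distinct  : AllPairs (λ e f → ¬ SameEdge e f) edges
    edgeCount : length edges ≡ numVertices m k ∸ 1
    connected : ∀ u v → length u ≤ k → length v ≤ k → Star (Adj edges) u v

open SpanningTree public

private
  ind : {m : ℕ} → Word m → Word m → ℕ
  ind v a with ≡-dec _≟_ a v
  ... | yes _ = 1
  ... | no _ = 0

degree : {m : ℕ} → List (Edge m) → Word m → ℕ
degree E v = sum (map (λ e → ind v (Data.Product.proj₁ e) + ind v (Data.Product.proj₂ e)) E)

MaxDegreeAtMost : {m k : ℕ} → SpanningTree m k → ℕ → Set
MaxDegreeAtMost {m} {k} T d = ∀ (v : Word m) → length v ≤ k → degree (edges T) v ≤ d

weight : {m k : ℕ} → SpanningTree m k → ℕ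
weight T = sum (map (λ e → treeDist (Data.Product.proj₁ e) (Data.Product.proj₂ e)) (edges T))

fracD : ℕ → (D : ℕ) → 3 ≤ D → ℚ
fracD a (suc (suc (suc j))) (s≤s (s≤s (s≤s _))) = + a / suc j

fromℕℚ : ℕ → ℚ
fromℕℚ a = + a / 1

-- Write h(v) = k − |v| for the height of a vertex of T_k, C = Σ_{i<k} n_i = Σ_v h(v), and l(e) for
-- the depth of the lowest common ancestor of the ends u, v of an edge e of T′. Then
-- dist(u,v) + h(u) + h(v) = 2(k − l(e)), and k − l(e) counts the depths i < k with l(e) ≤ i.
-- Contracting T_k to its top i + 1 levels, the connected T′ must join all n_{i+1} classes, so at least
-- n_{i+1} − 1 = (D − 1) n_i of its edges have l(e) ≤ i; summing over i, Σ_e (k − l(e)) ≥ (D − 1) C.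
-- By the handshake lemma Σ_e (h(u) + h(v)) = Σ_v deg(v) h(v) ≤ d C, hence w(T′) ≥ (2D − 2 − d) C.
-- Since n − 1 = (D − 2) C + k and k² ≤ 2(n − 1), this is w(T_k)(2 − (d−2)/(D−2)) up to an error
-- of at most w(T_k) ε(n) with ε(n) = 6 / (1 + ⌊√(2(n − 1))⌋).

module Submission where

open import Defs
open import Data.Nat using (ℕ; zero; suc; _+_; _*_; _∸_; _≤_; _<_; z≤n; s≤s; _≤?_)
open import Data.Nat.Properties hiding (_≟_)
open import Data.Nat.ListAction using (sum)
open import Data.Nat.ListAction.Properties using (sum-++)
open import Data.Nat.Tactic.RingSolver using (solve-∀)
open import Data.Fin using (_≟_)
open import Data.List using (List; []; _∷_; length; map; concatMap; allFin; _++_; filter; take; downFrom)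
open import Data.List.Properties using (≡-dec; ∷-injective; map-++; filter-accept; filter-reject; length-++; length-map; length-tabulate; take-all)
open import Data.List.Membership.Propositional using (_∈_; _∉_; find)
open import Data.List.Membership.Propositional.Properties
open import Data.List.Relation.Unary.Any using (here; there)
import Data.List.Relation.Unary.Any as Any
open import Data.List.Relation.Unary.All using (All; []; _∷_; all?)
import Data.List.Relation.Unary.All as All
import Data.List.Relation.Unary.All.Properties as Allₚ
open import Data.List.Relation.Unary.AllPairs using ([]; _∷_)
import Data.List.Relation.Unary.AllPairs as AllPairs
import Data.List.Relation.Unary.AllPairs.Properties as AllPairsₚ
open import Data.List.Relation.Unary.Unique.Propositional using (Unique)
import Data.List.Relation.Unary.Unique.Propositional.Properties as Unique
open import Data.List.Relation.Binary.Disjoint.Propositional using (Disjoint)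
open import Data.Product using (Σ; ∃; _×_; _,_; proj₁; proj₂)
open import Data.Sum using (_⊎_; inj₁; inj₂)
open import Data.Empty using (⊥-elim)
open import Relation.Nullary using (¬_; yes; no)
open import Relation.Unary using (Pred; Decidable)
open import Level using (0ℓ)
open import Relation.Binary.PropositionalEquality
open import Relation.Binary.Definitions using (DecidableEquality)
open import Relation.Binary.Construct.Closure.ReflexiveTransitive using (Star; _◅_) renaming (ε to ε★)
open import Function using (_∘_)
import Data.Integer as ℤ
import Data.Integer.Properties as ℤP
import Data.Integer.Tactic.RingSolver as ℤ-Solver
open import Data.Nat.Coprimality using (Coprime)
open import Data.Rational using (ℚ; mkℚ; _/_; 0ℚ; 1ℚ; ∣_∣; toℚᵘ; positive)
import Data.Rational as ℚ
import Data.Rational.Properties as ℚP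
open import Data.Rational.Unnormalised using (mkℚᵘ; *≤*; ↥_; ↧_)
import Data.Rational.Unnormalised as ℚᵘ
import Data.Rational.Unnormalised.Properties as ℚᵘP
open import Algebra.Properties.CommutativeSemigroup +-commutativeSemigroup using (interchange; x∙yz≈y∙xz)

private
  variable
    A : Set
    m : ℕ

sum-map-+ : (f g : A → ℕ) (xs : List A) →
            sum (map (λ x → f x + g x) xs) ≡ sum (map f xs) + sum (map g xs)
sum-map-+ f g [] = refl
sum-map-+ f g (x ∷ xs) =
  trans (cong (f x + g x +_) (sum-map-+ f g xs)) (interchange (f x) (g x) _ _)

sum-map-*ˡ : (c : ℕ) (f : A → ℕ) (xs : List A) →
             sum (map (λ x → c * f x) xs) ≡ c * sum (map f xs)
sum-map-*ˡ c f [] = sym (*-zeroʳ c)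
sum-map-*ˡ c f (x ∷ xs) =
  trans (cong (c * f x +_) (sum-map-*ˡ c f xs)) (sym (*-distribˡ-+ c (f x) _))

sum-map-suc : (f : A → ℕ) (xs : List A) →
              sum (map (λ x → suc (f x)) xs) ≡ length xs + sum (map f xs)
sum-map-suc f [] = refl
sum-map-suc f (x ∷ xs) = cong suc (trans (cong (f x +_) (sum-map-suc f xs)) (x∙yz≈y∙xz (f x) (length xs) _))

sum-map-cong : {f g : A → ℕ} (xs : List A) → (∀ {x} → x ∈ xs → f x ≡ g x) →
               sum (map f xs) ≡ sum (map g xs)
sum-map-cong [] eq = refl
sum-map-cong (x ∷ xs) eq = cong₂ _+_ (eq (here refl)) (sum-map-cong xs (eq ∘ there))

sum-map-zero : {f : A → ℕ} {xs : List A} → (∀ {x} → x ∈ xs → f x ≡ 0) → sum (map f xs) ≡ 0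
sum-map-zero {xs = []} _ = refl
sum-map-zero {xs = x ∷ xs} eq = cong₂ _+_ (eq (here refl)) (sum-map-zero (eq ∘ there))

sum-map-mono : {f g : A → ℕ} (xs : List A) → (∀ {x} → x ∈ xs → f x ≤ g x) →
               sum (map f xs) ≤ sum (map g xs)
sum-map-mono [] le = z≤n
sum-map-mono (x ∷ xs) le = +-mono-≤ (le (here refl)) (sum-map-mono xs (le ∘ there))

unique-⊆⇒length≤ : {xs ys : List A} → Unique xs → (∀ {x} → x ∈ xs → x ∈ ys) → length xs ≤ length ys
unique-⊆⇒length≤ {xs = []} _ _ = z≤n
unique-⊆⇒length≤ {xs = x ∷ xs} (x∉xs ∷ xs!) xs⊆ys with ∈-∃++ (xs⊆ys (here refl))
... | as , bs , refl = begin
  suc (length xs)               ≤⟨ s≤s (unique-⊆⇒length≤ xs! xs⊆as++bs) ⟩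
  suc (length (as ++ bs))       ≡⟨ cong suc (length-++ as) ⟩
  suc (length as + length bs)   ≡⟨ +-suc (length as) _ ⟨
  length as + length (x ∷ bs)   ≡⟨ length-++ as ⟨
  length (as ++ x ∷ bs)         ∎
  where
  open ≤-Reasoning
  xs⊆as++bs : ∀ {y} → y ∈ xs → y ∈ as ++ bs
  xs⊆as++bs {y} y∈xs with ∈-++⁻ as (xs⊆ys (there y∈xs))
  ... | inj₁ y∈as = ∈-++⁺ˡ y∈as
  ... | inj₂ (here refl) = ⊥-elim (All.lookup x∉xs y∈xs refl)
  ... | inj₂ (there y∈bs) = ∈-++⁺ʳ as y∈bs

sum-map-suc-∸ : (f : A → ℕ) (j : ℕ) (xs : List A) →
                sum (map (λ x → suc j ∸ f x) xs) ≡ length (filter (λ x → f x ≤? j) xs) + sum (map (λ x → j ∸ f x) xs)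
sum-map-suc-∸ f j [] = refl
sum-map-suc-∸ f j (x ∷ xs) with f x ≤? j
... | yes fx≤j rewrite filter-accept (λ x → f x ≤? j) {xs = xs} fx≤j =
  trans (cong₂ _+_ (+-∸-assoc 1 fx≤j) (sum-map-suc-∸ f j xs)) (cong suc (x∙yz≈y∙xz (j ∸ f x) (length (filter (λ x → f x ≤? j) xs)) _))
... | no fx≰j rewrite filter-reject (λ x → f x ≤? j) {xs = xs} fx≰j
                    | m≤n⇒m∸n≡0 (≰⇒> fx≰j) | m≤n⇒m∸n≡0 (<⇒≤ (≰⇒> fx≰j)) = sum-map-suc-∸ f j xs

children : Word m → List (Word m)
children {m} w = map (_∷ w) (allFin m)

∈-children⁻ : {u w : Word m} → u ∈ children w → ∃ λ x → u ≡ x ∷ w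
∈-children⁻ u∈ with ∈-map⁻ _ u∈
... | x , _ , u≡x∷w = x , u≡x∷w

∈-wordsOfLen⁻ : ∀ i {u : Word m} → u ∈ wordsOfLen m i → length u ≡ i
∈-wordsOfLen⁻ zero (here refl) = refl
∈-wordsOfLen⁻ (suc i) u∈ with find (∈-concatMap⁻ children {xs = wordsOfLen _ i} u∈)
... | w , w∈ , u∈children with ∈-children⁻ u∈children
... | _ , refl = cong suc (∈-wordsOfLen⁻ i w∈)

∈-wordsOfLen⁺ : (u : Word m) → u ∈ wordsOfLen m (length u)
∈-wordsOfLen⁺ [] = here refl
∈-wordsOfLen⁺ (x ∷ w) = ∈-concatMap⁺ children {xs = wordsOfLen _ (length w)}
  (Any.map (λ { refl → ∈-map⁺ (_∷ w) (∈-allFin x) }) (∈-wordsOfLen⁺ w))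

wordsOfLen-unique : ∀ m i → Unique (wordsOfLen m i)
wordsOfLen-unique m zero = [] ∷ []
wordsOfLen-unique m (suc i) = Unique.concat⁺
  (Allₚ.map⁺ (All.universal (λ w → Unique.map⁺ (proj₁ ∘ ∷-injective) (Unique.allFin⁺ m)) _))
  (AllPairsₚ.map⁺ (AllPairs.map children-disjoint (wordsOfLen-unique m i)))
  where
  children-disjoint : {w w′ : Word m} → w ≢ w′ → Disjoint (children w) (children w′)
  children-disjoint w≢w′ (u∈ , u∈′) with ∈-children⁻ u∈ | ∈-children⁻ u∈′
  ... | _ , refl | _ , eq = w≢w′ (proj₂ (∷-injective eq))

length-wordsOfLen : ∀ m i → length (wordsOfLen m (suc i)) ≡ m * length (wordsOfLen m i)
length-wordsOfLen m i = length-concatMap-children (wordsOfLen m i)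
  where
  length-concatMap-children : (ws : List (Word m)) → length (concatMap children ws) ≡ m * length ws
  length-concatMap-children [] = sym (*-zeroʳ m)
  length-concatMap-children (w ∷ ws) = begin
    length (children w ++ concatMap children ws)  ≡⟨ length-++ (children w) ⟩
    length (children w) + length (concatMap children ws)
      ≡⟨ cong₂ _+_ (trans (length-map _ (allFin m)) (length-tabulate (λ x → x))) (length-concatMap-children ws) ⟩
    m + m * length ws                              ≡⟨ *-suc m (length ws) ⟨
    m * suc (length ws)                            ∎
    where open ≡-Reasoning

∈-vertices⁻ : ∀ k {u : Word m} → u ∈ vertices m k → length u ≤ k
∈-vertices⁻ zero (here refl) = z≤n
∈-vertices⁻ (suc k) u∈ with ∈-++⁻ (vertices _ k) u∈
... | inj₁ u∈V = m≤n⇒m≤1+n (∈-vertices⁻ k u∈V)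
... | inj₂ u∈W = ≤-reflexive (∈-wordsOfLen⁻ (suc k) u∈W)

∈-vertices⁺ : ∀ k {u : Word m} → length u ≤ k → u ∈ vertices m k
∈-vertices⁺ zero {[]} _ = here refl
∈-vertices⁺ (suc k) {u} |u|≤1+k with m≤n⇒m<n∨m≡n |u|≤1+k
... | inj₁ (s≤s |u|≤k) = ∈-++⁺ˡ (∈-vertices⁺ k |u|≤k)
... | inj₂ |u|≡1+k = ∈-++⁺ʳ (vertices _ k) (subst (λ i → u ∈ wordsOfLen _ i) |u|≡1+k (∈-wordsOfLen⁺ u))

vertices-unique : ∀ m k → Unique (vertices m k)
vertices-unique m zero = [] ∷ []
vertices-unique m (suc k) = Unique.++⁺ (vertices-unique m k) (wordsOfLen-unique m (suc k))
  λ (u∈V , u∈W) → <-irrefl (∈-wordsOfLen⁻ (suc k) u∈W) (s≤s (∈-vertices⁻ k u∈V))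

numVertices-suc : ∀ m k → numVertices m (suc k) ≡ suc (m * numVertices m k)
numVertices-suc m zero = cong suc (length-wordsOfLen m 0)
numVertices-suc m (suc k) = begin
  length (vertices m (suc k) ++ Wₖ₊₂)               ≡⟨ length-++ (vertices m (suc k)) ⟩
  numVertices m (suc k) + length Wₖ₊₂              ≡⟨ cong₂ _+_ (numVertices-suc m k) (length-wordsOfLen m (suc k)) ⟩
  suc (m * numVertices m k + m * length Wₖ₊₁)      ≡⟨ cong suc (*-distribˡ-+ m (numVertices m k) _) ⟨
  suc (m * (numVertices m k + length Wₖ₊₁))        ≡⟨ cong (suc ∘ (m *_)) (length-++ (vertices m k)) ⟨
  suc (m * numVertices m (suc k))                  ∎
  where
  open ≡-Reasoning
  Wₖ₊₁ = wordsOfLen m (suc k)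
  Wₖ₊₂ = wordsOfLen m (suc (suc k))

height : ℕ → Word m → ℕ
height k u = k ∸ length u

cumulativeNumVertices : ℕ → ℕ → ℕ
cumulativeNumVertices m k = sum (map (numVertices m) (downFrom k))

sum-height : ∀ m k → sum (map (height k) (vertices m k)) ≡ cumulativeNumVertices m k
sum-height m zero = refl
sum-height m (suc k) = begin
  sum (map (height (suc k)) (vertices m k ++ wordsOfLen m (suc k)))
    ≡⟨ cong sum (map-++ (height (suc k)) (vertices m k) _) ⟩
  sum (map (height (suc k)) (vertices m k) ++ map (height (suc k)) (wordsOfLen m (suc k)))
    ≡⟨ sum-++ (map (height (suc k)) (vertices m k)) _ ⟩
  sum (map (height (suc k)) (vertices m k)) + sum (map (height (suc k)) (wordsOfLen m (suc k)))
    ≡⟨ cong₂ _+_ (sum-map-cong (vertices m k) (λ u∈ → +-∸-assoc 1 (∈-vertices⁻ k u∈)))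
                 (sum-map-zero (λ u∈ → trans (cong (suc k ∸_) (∈-wordsOfLen⁻ (suc k) u∈)) (n∸n≡0 (suc k)))) ⟩
  sum (map (λ u → suc (height k u)) (vertices m k)) + 0
    ≡⟨ +-identityʳ _ ⟩
  sum (map (λ u → suc (height k u)) (vertices m k))
    ≡⟨ sum-map-suc (height k) (vertices m k) ⟩
  numVertices m k + sum (map (height k) (vertices m k))
    ≡⟨ cong (numVertices m k +_) (sum-height m k) ⟩
  numVertices m k + cumulativeNumVertices m k ∎
  where open ≡-Reasoning

numVertices-closed : ∀ β k → numVertices (suc β) k ≡ suc (β * cumulativeNumVertices (suc β) k + k)
numVertices-closed β zero = cong suc (sym (trans (+-identityʳ _) (*-zeroʳ β)))
numVertices-closed β (suc k) = begin
  numVertices (suc β) (suc k)              ≡⟨ numVertices-suc (suc β) k ⟩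
  suc (suc β * N)                          ≡⟨ cong (λ n → suc (suc β * n)) (numVertices-closed β k) ⟩
  suc (suc β * suc (β * C + k))            ≡⟨ cong suc (rearrange β C k) ⟩
  suc (β * (suc (β * C + k) + C) + suc k)  ≡⟨ cong (λ n → suc (β * (n + C) + suc k)) (numVertices-closed β k) ⟨
  suc (β * (N + C) + suc k)                ∎
  where
  open ≡-Reasoning
  N = numVertices (suc β) k
  C = cumulativeNumVertices (suc β) k
  rearrange : ∀ β C k → suc β * suc (β * C + k) ≡ β * (suc (β * C + k) + C) + suc k
  rearrange = solve-∀

k*[1+k]≤2*cumulative : ∀ β k → k * suc k ≤ 2 * cumulativeNumVertices (suc β) k
k*[1+k]≤2*cumulative β zero = z≤n
k*[1+k]≤2*cumulative β (suc k) = begin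
  suc k * suc (suc k)     ≡⟨ split k ⟩
  k * suc k + 2 * suc k   ≤⟨ +-mono-≤ (k*[1+k]≤2*cumulative β k) (*-monoʳ-≤ 2 1+k≤N) ⟩
  2 * C + 2 * N           ≡⟨ *-distribˡ-+ 2 C N ⟨
  2 * (C + N)             ≡⟨ cong (2 *_) (+-comm C N) ⟩
  2 * (N + C)             ∎
  where
  open ≤-Reasoning
  N = numVertices (suc β) k
  C = cumulativeNumVertices (suc β) k
  split : ∀ k → suc k * suc (suc k) ≡ k * suc k + 2 * suc k
  split = solve-∀
  1+k≤N : suc k ≤ N
  1+k≤N = subst (suc k ≤_) (sym (numVertices-closed β k)) (s≤s (m≤n+m k _))

k²≤2[n∸1] : ∀ β k → k * k ≤ 2 * (numVertices (suc (suc β)) k ∸ 1)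
k²≤2[n∸1] β k = begin
  k * k                   ≤⟨ *-monoʳ-≤ k (n≤1+n k) ⟩
  k * suc k               ≤⟨ k*[1+k]≤2*cumulative (suc β) k ⟩
  2 * C                   ≤⟨ *-monoʳ-≤ 2 (≤-trans (m≤m+n C (β * C)) (m≤m+n (suc β * C) k)) ⟩
  2 * (suc β * C + k)     ≡⟨ cong (λ n → 2 * (n ∸ 1)) (numVertices-closed (suc β) k) ⟨
  2 * (numVertices (suc (suc β)) k ∸ 1) ∎
  where
  open ≤-Reasoning
  C = cumulativeNumVertices (suc (suc β)) k

δ : Word m → Word m → ℕ
δ u v with ≡-dec _≟_ u v
... | yes _ = 1
... | no _ = 0

degree-∷ : (u v : Word m) (E : List (Edge m)) (w : Word m) →
           degree ((u , v) ∷ E) w ≡ δ u w + δ v w + degree E w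
degree-∷ u v E w with ≡-dec _≟_ u w | ≡-dec _≟_ v w
... | yes _ | yes _ = refl
... | yes _ | no _  = refl
... | no _  | yes _ = refl
... | no _  | no _  = refl

≤-sum-δ : (h : Word m → ℕ) {u : Word m} {V : List (Word m)} → u ∈ V →
          h u ≤ sum (map (λ w → δ u w * h w) V)
≤-sum-δ h {u} (here refl) with ≡-dec _≟_ u u
... | yes _ = ≤-trans (≤-reflexive (sym (+-identityʳ (h u)))) (m≤m+n _ _)
... | no u≢u = ⊥-elim (u≢u refl)
≤-sum-δ h (there u∈V) = ≤-trans (≤-sum-δ h u∈V) (m≤n+m _ _)

handshake-≤ : (h : Word m → ℕ) (V : List (Word m)) (E : List (Edge m)) →
              (∀ {e} → e ∈ E → proj₁ e ∈ V × proj₂ e ∈ V) →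
              sum (map (λ e → h (proj₁ e) + h (proj₂ e)) E) ≤ sum (map (λ w → degree E w * h w) V)
handshake-≤ h V [] _ = z≤n
handshake-≤ h V ((u , v) ∷ E) ends = begin
  h u + h v + sum (map (λ e → h (proj₁ e) + h (proj₂ e)) E)
    ≤⟨ +-mono-≤ (+-mono-≤ (≤-sum-δ h (proj₁ (ends (here refl)))) (≤-sum-δ h (proj₂ (ends (here refl)))))
                (handshake-≤ h V E (ends ∘ there)) ⟩
  ∑ (λ w → δ u w * h w) + ∑ (λ w → δ v w * h w) + ∑ (λ w → degree E w * h w)
    ≡⟨ cong (_+ ∑ (λ w → degree E w * h w)) (sum-map-+ (λ w → δ u w * h w) _ V) ⟨
  ∑ (λ w → δ u w * h w + δ v w * h w) + ∑ (λ w → degree E w * h w)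
    ≡⟨ sum-map-+ (λ w → δ u w * h w + δ v w * h w) _ V ⟨
  ∑ (λ w → δ u w * h w + δ v w * h w + degree E w * h w)
    ≡⟨ sum-map-cong V (λ {w} _ → degree-∷-* w) ⟨
  ∑ (λ w → degree ((u , v) ∷ E) w * h w) ∎
  where
  open ≤-Reasoning
  ∑ : (Word _ → ℕ) → ℕ
  ∑ f = sum (map f V)
  degree-∷-* : ∀ w → degree ((u , v) ∷ E) w * h w ≡ δ u w * h w + δ v w * h w + degree E w * h w
  degree-∷-* w = begin-equality
    degree ((u , v) ∷ E) w * h w                  ≡⟨ cong (_* h w) (degree-∷ u v E w) ⟩
    (δ u w + δ v w + degree E w) * h w            ≡⟨ *-distribʳ-+ (h w) (δ u w + δ v w) _ ⟩
    (δ u w + δ v w) * h w + degree E w * h w      ≡⟨ cong (_+ degree E w * h w) (*-distribʳ-+ (h w) (δ u w) _) ⟩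
    δ u w * h w + δ v w * h w + degree E w * h w  ∎

module _ {A : Set} (_≟ᴬ_ : DecidableEquality A) where

  open import Data.List.Membership.DecPropositional _≟ᴬ_ using (_∈?_)

  length<⇒∃∉ : {R V : List A} → Unique V → length R < length V → ∃ λ a → a ∈ V × a ∉ R
  length<⇒∃∉ {R} {V} V! |R|<|V| with all? (_∈? R) V
  ... | yes V⊆R = ⊥-elim (<⇒≱ |R|<|V| (unique-⊆⇒length≤ V! (All.lookup V⊆R)))
  ... | no V⊈R = find (Allₚ.¬All⇒Any¬ (_∈? R) V V⊈R)

  module _ {m : ℕ} (τ : Word m → A) (E : List (Edge m)) where

    Leaves : List A → Edge m → Set
    Leaves R (u , v) = (τ u ∈ R × τ v ∉ R) ⊎ (τ v ∈ R × τ u ∉ R)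

    path-leaves : {R : List A} {x y : Word m} → Star (Adj E) x y → τ x ∈ R → τ y ∉ R →
                  ∃ λ e → e ∈ E × Leaves R e
    path-leaves ε★ x∈R y∉R = ⊥-elim (y∉R x∈R)
    path-leaves {R} (_◅_ {j = z} x~z z⇝y) x∈R y∉R with τ z ∈? R | x~z
    ... | yes z∈R | _         = path-leaves z⇝y z∈R y∉R
    ... | no z∉R  | inj₁ xz∈E = _ , xz∈E , inj₁ (x∈R , z∉R)
    ... | no z∉R  | inj₂ zx∈E = _ , zx∈E , inj₂ (x∈R , z∉R)

    -- Prim's algorithm on the image of the graph under τ: while some image in V is unreached,
    -- the path from b₀ to a preimage of it leaves the reached set along a new edge.
    module _ (b₀ : Word m) (V : List A) (V! : Unique V)
             (reach : ∀ {a} → a ∈ V → ∃ λ b → τ b ≡ a × Star (Adj E) b₀ b) where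

      record Fragment (t : ℕ) : Set where
        field
          reached    : List A
          tree       : List (Edge m)
          |reached|  : length reached ≡ suc t
          |tree|     : length tree ≡ t
          tree!      : Unique tree
          tree⊆E     : ∀ {e} → e ∈ tree → e ∈ E
          crossing   : ∀ {e} → e ∈ tree → τ (proj₁ e) ≢ τ (proj₂ e)
          inside     : ∀ {e} → e ∈ tree → τ (proj₁ e) ∈ reached × τ (proj₂ e) ∈ reached
          root       : τ b₀ ∈ reached

      open Fragment

      extend-by : ∀ {t} (F : Fragment t) (a : A) (e : Edge m) → e ∈ E → τ (proj₁ e) ≢ τ (proj₂ e) →
                  ¬ (τ (proj₁ e) ∈ reached F × τ (proj₂ e) ∈ reached F) →
                  τ (proj₁ e) ∈ a ∷ reached F × τ (proj₂ e) ∈ a ∷ reached F → Fragment (suc t)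
      extend-by F a e e∈E e-crossing e-new e-inside = record
        { reached   = a ∷ reached F
        ; tree      = e ∷ tree F
        ; |reached| = cong suc (|reached| F)
        ; |tree|    = cong suc (|tree| F)
        ; tree!     = All.tabulate (λ f∈ e≡f → e-new (subst _ (sym e≡f) (inside F f∈))) ∷ tree! F
        ; tree⊆E    = λ { (here refl) → e∈E ; (there f∈) → tree⊆E F f∈ }
        ; crossing  = λ { (here refl) → e-crossing ; (there f∈) → crossing F f∈ }
        ; inside    = λ { (here refl) → e-inside ; (there f∈) → Data.Product.map there there (inside F f∈) }
        ; root      = there (root F)
        }

      extend : ∀ {t} (F : Fragment t) (e : Edge m) → e ∈ E → Leaves (reached F) e → Fragment (suc t)
      extend F (u , v) e∈E (inj₁ (u∈ , v∉)) =
        extend-by F (τ v) _ e∈E (λ eq → v∉ (subst (_∈ _) eq u∈)) (v∉ ∘ proj₂) (there u∈ , here refl)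
      extend F (u , v) e∈E (inj₂ (v∈ , u∉)) =
        extend-by F (τ u) _ e∈E (λ eq → u∉ (subst (_∈ _) (sym eq) v∈)) (u∉ ∘ proj₁) (here refl , there v∈)

      fragment : ∀ t → t < length V → Fragment t
      fragment zero _ = record
        { reached = τ b₀ ∷ [] ; tree = [] ; |reached| = refl ; |tree| = refl ; tree! = []
        ; tree⊆E = λ () ; crossing = λ () ; inside = λ () ; root = here refl }
      fragment (suc t) t<|V| with fragment t (<-trans (n<1+n t) t<|V|)
      ... | F with length<⇒∃∉ V! (subst (_< length V) (sym (|reached| F)) t<|V|)
      ... | a , a∈V , a∉R with reach a∈V
      ... | b , refl , b₀⇝b with path-leaves b₀⇝b (root F) a∉R
      ... | e , e∈E , e-leaves = extend F e e∈E e-leaves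

      crossing-edges : {P : Pred (Edge m) 0ℓ} (P? : Decidable P) →
                       (∀ {e} → τ (proj₁ e) ≢ τ (proj₂ e) → P e) →
                       ∀ t → t < length V → t ≤ length (filter P? E)
      crossing-edges P? crossing⇒P t t<|V| = subst (_≤ _) (|tree| F)
        (unique-⊆⇒length≤ (tree! F) (λ e∈ → ∈-filter⁺ P? (tree⊆E F e∈) (crossing⇒P (crossing F e∈))))
        where F = fragment t t<|V|

lcpLen-≤ˡ : (u v : Word m) → lcpLen u v ≤ length u
lcpLen-≤ˡ [] _ = z≤n
lcpLen-≤ˡ (_ ∷ _) [] = z≤n
lcpLen-≤ˡ (x ∷ u) (y ∷ v) with x ≟ y
... | yes _ = s≤s (lcpLen-≤ˡ u v)
... | no _ = z≤n

lcpLen-≤ʳ : (u v : Word m) → lcpLen u v ≤ length v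
lcpLen-≤ʳ [] _ = z≤n
lcpLen-≤ʳ (_ ∷ _) [] = z≤n
lcpLen-≤ʳ (x ∷ u) (y ∷ v) with x ≟ y
... | yes _ = s≤s (lcpLen-≤ʳ u v)
... | no _ = z≤n

take-lcpLen : ∀ i (u v : Word m) → i ≤ lcpLen u v → take i u ≡ take i v
take-lcpLen zero u v _ = refl
take-lcpLen (suc i) (x ∷ u) (y ∷ v) i<lcp with x ≟ y
take-lcpLen (suc i) (x ∷ u) (.x ∷ v) (s≤s i≤lcp) | yes refl = cong (x ∷_) (take-lcpLen i u v i≤lcp)

[m∸n]+[o∸m]≡o∸n : ∀ {m n o} → n ≤ m → m ≤ o → (m ∸ n) + (o ∸ m) ≡ o ∸ n
[m∸n]+[o∸m]≡o∸n {m} {n} {o} n≤m m≤o = begin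
  (m ∸ n) + (o ∸ m)  ≡⟨ +-comm (m ∸ n) _ ⟩
  (o ∸ m) + (m ∸ n)  ≡⟨ +-∸-assoc (o ∸ m) n≤m ⟨
  (o ∸ m) + m ∸ n    ≡⟨ cong (_∸ n) (m∸n+n≡m m≤o) ⟩
  o ∸ n              ∎
  where open ≡-Reasoning

treeDist-via-lca : (u v : Word m) →
                   treeDist u v ≡ (length u ∸ lcpLen u v) + (length v ∸ lcpLen u v)
treeDist-via-lca u v = begin
  length u + length v ∸ (l + (l + 0))   ≡⟨ cong (λ x → length u + length v ∸ (l + x)) (+-identityʳ l) ⟩
  length u + length v ∸ (l + l)         ≡⟨ ∸-+-assoc (length u + length v) l l ⟨
  length u + length v ∸ l ∸ l           ≡⟨ cong (_∸ l) (+-∸-comm (length v) (lcpLen-≤ˡ u v)) ⟩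
  (length u ∸ l) + length v ∸ l         ≡⟨ +-∸-assoc (length u ∸ l) (lcpLen-≤ʳ u v) ⟩
  (length u ∸ l) + (length v ∸ l)       ∎
  where
  open ≡-Reasoning
  l = lcpLen u v

treeDist+heights : ∀ {k} (u v : Word m) → length u ≤ k → length v ≤ k →
                   treeDist u v + (height k u + height k v) ≡ (k ∸ lcpLen u v) + (k ∸ lcpLen u v)
treeDist+heights {k = k} u v |u|≤k |v|≤k = begin
  treeDist u v + (height k u + height k v)
    ≡⟨ cong (_+ (height k u + height k v)) (treeDist-via-lca u v) ⟩
  (length u ∸ l) + (length v ∸ l) + ((k ∸ length u) + (k ∸ length v))
    ≡⟨ interchange (length u ∸ l) _ _ _ ⟩
  ((length u ∸ l) + (k ∸ length u)) + ((length v ∸ l) + (k ∸ length v))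
    ≡⟨ cong₂ _+_ ([m∸n]+[o∸m]≡o∸n (lcpLen-≤ˡ u v) |u|≤k) ([m∸n]+[o∸m]≡o∸n (lcpLen-≤ʳ u v) |v|≤k) ⟩
  (k ∸ l) + (k ∸ l) ∎
  where
  open ≡-Reasoning
  l = lcpLen u v

module _ {m k : ℕ} (T : SpanningTree m k) where

  lcpLenᴱ : Edge m → ℕ
  lcpLenᴱ (u , v) = lcpLen u v

  endpoints-≤ : ∀ {e} → e ∈ edges T → length (proj₁ e) ≤ k × length (proj₂ e) ≤ k
  endpoints-≤ = All.lookup (inVertex T)

  cut-bound : ∀ j → suc j ≤ k → m * numVertices m j ≤ length (filter (λ e → lcpLenᴱ e ≤? j) (edges T))
  cut-bound j j<k =
    crossing-edges (≡-dec _≟_) (take (suc j)) (edges T) [] (vertices m (suc j)) (vertices-unique m (suc j)) reach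
      (λ e → lcpLenᴱ e ≤? j) (λ {e} → separated⇒lcpLen≤ (proj₁ e) (proj₂ e))
      (m * numVertices m j) (≤-reflexive (sym (numVertices-suc m j)))
    where
    reach : ∀ {u} → u ∈ vertices m (suc j) → ∃ λ v → take (suc j) v ≡ u × Star (Adj (edges T)) [] v
    reach {u} u∈ = u , take-all (suc j) u (∈-vertices⁻ (suc j) u∈)
                 , connected T [] u z≤n (≤-trans (∈-vertices⁻ (suc j) u∈) j<k)
    separated⇒lcpLen≤ : (u v : Word m) → take (suc j) u ≢ take (suc j) v → lcpLen u v ≤ j
    separated⇒lcpLen≤ u v ≢ with lcpLen u v ≤? j
    ... | yes l≤j = l≤j
    ... | no l≰j = ⊥-elim (≢ (take-lcpLen (suc j) u v (≰⇒> l≰j)))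

  cut-sum-bound : ∀ j → j ≤ k → m * cumulativeNumVertices m j ≤ sum (map (λ e → j ∸ lcpLenᴱ e) (edges T))
  cut-sum-bound zero _ = ≤-reflexive (trans (*-zeroʳ m) (sym (sum-map-zero {f = λ e → 0 ∸ lcpLenᴱ e} {xs = edges T} (λ {e} _ → 0∸n≡0 (lcpLenᴱ e)))))
  cut-sum-bound (suc j) j<k = begin
    m * (numVertices m j + cumulativeNumVertices m j)         ≡⟨ *-distribˡ-+ m (numVertices m j) _ ⟩
    m * numVertices m j + m * cumulativeNumVertices m j       ≤⟨ +-mono-≤ (cut-bound j j<k) (cut-sum-bound j (<⇒≤ j<k)) ⟩
    length (filter (λ e → lcpLenᴱ e ≤? j) (edges T)) + sum (map (λ e → j ∸ lcpLenᴱ e) (edges T))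
                                                               ≡⟨ sum-map-suc-∸ lcpLenᴱ j (edges T) ⟨
    sum (map (λ e → suc j ∸ lcpLenᴱ e) (edges T))             ∎
    where open ≤-Reasoning

  weight+heights : weight T + sum (map (λ e → height k (proj₁ e) + height k (proj₂ e)) (edges T))
                   ≡ sum (map (λ e → k ∸ lcpLenᴱ e) (edges T)) + sum (map (λ e → k ∸ lcpLenᴱ e) (edges T))
  weight+heights = begin
    weight T + sum (map (λ e → height k (proj₁ e) + height k (proj₂ e)) (edges T))
      ≡⟨ sum-map-+ (λ e → treeDist (proj₁ e) (proj₂ e)) _ (edges T) ⟨
    sum (map (λ e → treeDist (proj₁ e) (proj₂ e) + (height k (proj₁ e) + height k (proj₂ e))) (edges T))
      ≡⟨ sum-map-cong (edges T) (λ {e} e∈ → treeDist+heights (proj₁ e) (proj₂ e) (proj₁ (endpoints-≤ e∈)) (proj₂ (endpoints-≤ e∈))) ⟩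
    sum (map (λ e → (k ∸ lcpLenᴱ e) + (k ∸ lcpLenᴱ e)) (edges T))
      ≡⟨ sum-map-+ (λ e → k ∸ lcpLenᴱ e) _ (edges T) ⟩
    sum (map (λ e → k ∸ lcpLenᴱ e) (edges T)) + sum (map (λ e → k ∸ lcpLenᴱ e) (edges T)) ∎
    where open ≡-Reasoning

  sum-endpoint-heights-≤ : ∀ d → MaxDegreeAtMost T d →
              sum (map (λ e → height k (proj₁ e) + height k (proj₂ e)) (edges T)) ≤ d * cumulativeNumVertices m k
  sum-endpoint-heights-≤ d deg≤d = begin
    sum (map (λ e → height k (proj₁ e) + height k (proj₂ e)) (edges T))
      ≤⟨ handshake-≤ (height k) (vertices m k) (edges T)
           (λ e∈ → ∈-vertices⁺ k (proj₁ (endpoints-≤ e∈)) , ∈-vertices⁺ k (proj₂ (endpoints-≤ e∈))) ⟩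
    sum (map (λ u → degree (edges T) u * height k u) (vertices m k))
      ≤⟨ sum-map-mono (vertices m k) (λ {u} u∈ → *-monoˡ-≤ (height k u) (deg≤d u (∈-vertices⁻ k u∈))) ⟩
    sum (map (λ u → d * height k u) (vertices m k))
      ≡⟨ sum-map-*ˡ d (height k) (vertices m k) ⟩
    d * sum (map (height k) (vertices m k))
      ≡⟨ cong (d *_) (sum-height m k) ⟩
    d * cumulativeNumVertices m k ∎
    where open ≤-Reasoning

  weight-≥ : ∀ d → MaxDegreeAtMost T d →
             (m + m) * cumulativeNumVertices m k ≤ weight T + d * cumulativeNumVertices m k
  weight-≥ d deg≤d = begin
    (m + m) * C                ≡⟨ *-distribʳ-+ C m m ⟩
    m * C + m * C              ≤⟨ +-mono-≤ (cut-sum-bound k ≤-refl) (cut-sum-bound k ≤-refl) ⟩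
    Λ + Λ                      ≡⟨ weight+heights ⟨
    weight T + H               ≤⟨ +-monoʳ-≤ (weight T) (sum-endpoint-heights-≤ d deg≤d) ⟩
    weight T + d * C           ∎
    where
    open ≤-Reasoning
    C = cumulativeNumVertices m k
    Λ = sum (map (λ e → k ∸ lcpLenᴱ e) (edges T))
    H = sum (map (λ e → height k (proj₁ e) + height k (proj₂ e)) (edges T))

isqrt : ℕ → ℕ
isqrt zero = 0
isqrt (suc x) with suc (isqrt x) * suc (isqrt x) ≤? suc x
... | yes _ = suc (isqrt x)
... | no _ = isqrt x

isqrt-spec : ∀ x → isqrt x * isqrt x ≤ x × x < suc (isqrt x) * suc (isqrt x)
isqrt-spec zero = z≤n , s≤s z≤n
isqrt-spec (suc x) with suc (isqrt x) * suc (isqrt x) ≤? suc x | isqrt-spec x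
... | yes r²≤x | _ , x<r² = r²≤x , ≤-trans (s≤s x<r²) (square-suc-< (isqrt x))
  where
  square-suc-< : ∀ r → suc (suc r * suc r) ≤ suc (suc r) * suc (suc r)
  square-suc-< r = subst (suc (suc r * suc r) ≤_) (sym (expand r)) (m≤m+n _ _)
    where
    expand : ∀ r → suc (suc r) * suc (suc r) ≡ suc (suc r * suc r) + (2 * r + 2)
    expand = solve-∀
... | no r²≰x | s²≤x , _ = m≤n⇒m≤1+n s²≤x , ≰⇒> r²≰x

≤-isqrt : ∀ {r x} → r * r ≤ x → r ≤ isqrt x
≤-isqrt {r} {x} r²≤x with r ≤? isqrt x
... | yes r≤s = r≤s
... | no r≰s = ⊥-elim (<⇒≱ (proj₂ (isqrt-spec x)) (≤-trans (*-mono-≤ (≰⇒> r≰s) (≰⇒> r≰s)) r²≤x))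

cleared-bound : ∀ β e C k W s X →
  (suc β + suc β) * C ≤ W + (e + 2) * C → X ≡ β * C + k → s * s ≤ 2 * X → k ≤ s →
  2 * (β * suc s) * X ≤ W * (β * suc s) + X * (e * suc s + 6 * β)
cleared-bound β e C k W s X hW X≡βC+k s²≤2X k≤s = begin
  2 * (β * suc s) * X                              ≡⟨ cong (2 * (β * suc s) *_) X≡βC+k ⟩
  2 * (β * suc s) * (β * C + k)                    ≡⟨ split₁ β s C k ⟩
  β * suc s * (2 * β * C) + 2 * β * (k * suc s)    ≤⟨ +-mono-≤ (*-monoʳ-≤ (β * suc s) 2βC≤W+eC) (*-monoʳ-≤ (2 * β) k[1+s]≤3X) ⟩
  β * suc s * (W + e * C) + 2 * β * (3 * X)        ≡⟨ split₂ β s W e C X ⟩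
  W * (β * suc s) + e * suc s * (β * C) + 6 * β * X ≤⟨ +-monoˡ-≤ (6 * β * X) (+-monoʳ-≤ (W * (β * suc s)) (*-monoʳ-≤ (e * suc s) βC≤X)) ⟩
  W * (β * suc s) + e * suc s * X + 6 * β * X      ≡⟨ join β s W e X ⟩
  W * (β * suc s) + X * (e * suc s + 6 * β)        ∎
  where
  open ≤-Reasoning
  βC≤X : β * C ≤ X
  βC≤X = ≤-trans (m≤m+n (β * C) k) (≤-reflexive (sym X≡βC+k))
  2βC≤W+eC : 2 * β * C ≤ W + e * C
  2βC≤W+eC = +-cancelʳ-≤ (2 * C) _ _ (subst₂ _≤_ (e₁ β C) (e₂ W e C) hW)
    where
    e₁ : ∀ β C → (suc β + suc β) * C ≡ 2 * β * C + 2 * C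
    e₁ = solve-∀
    e₂ : ∀ W e C → W + (e + 2) * C ≡ W + e * C + 2 * C
    e₂ = solve-∀
  k[1+s]≤3X : k * suc s ≤ 3 * X
  k[1+s]≤3X = begin
    k * suc s         ≡⟨ *-suc k s ⟩
    k + k * s         ≤⟨ +-mono-≤ (≤-trans (m≤n+m k (β * C)) (≤-reflexive (sym X≡βC+k))) (≤-trans (*-monoˡ-≤ s k≤s) s²≤2X) ⟩
    X + 2 * X         ≡⟨ three X ⟩
    3 * X             ∎
    where
    three : ∀ X → X + 2 * X ≡ 3 * X
    three = solve-∀
  split₁ : ∀ β s C k → 2 * (β * suc s) * (β * C + k) ≡ β * suc s * (2 * β * C) + 2 * β * (k * suc s)
  split₁ = solve-∀
  split₂ : ∀ β s W e C X → β * suc s * (W + e * C) + 2 * β * (3 * X) ≡ W * (β * suc s) + e * suc s * (β * C) + 6 * β * X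
  split₂ = solve-∀
  join : ∀ β s W e X → W * (β * suc s) + e * suc s * X + 6 * β * X ≡ W * (β * suc s) + X * (e * suc s + 6 * β)
  join = solve-∀

-- Opened only now: ℤ's prefix +_ makes sections such as (x +_) of ℕ's _+_ ambiguous.
open import Data.Integer using (+_; -[1+_])

two-minus-fractions-≤ : ∀ x w a b c t →
  2 * (suc b * suc t) * x ≤ w * (suc b * suc t) + x * (a * suc t + c * suc b) →
  fromℕℚ x ℚ.* ((1ℚ ℚ.+ 1ℚ) ℚ.- + a / suc b ℚ.- + c / suc t) ℚ.≤ fromℕℚ w
two-minus-fractions-≤ x w a b c t le =
  ℚP.toℚᵘ-cancel-≤ (ℚᵘP.≤-respˡ-≃ (ℚᵘP.≃-sym lhs≃) (ℚᵘP.≤-respʳ-≃ (ℚᵘP.≃-sym (ℚP.toℚᵘ-fromℚᵘ (mkℚᵘ (+ w) 0))) (*≤* cross)))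
  where
  1ᵘ = mkℚᵘ (+ 1) 0
  L = mkℚᵘ (+ x) 0 ℚᵘ.* ((1ᵘ ℚᵘ.+ 1ᵘ) ℚᵘ.- mkℚᵘ (+ a) b ℚᵘ.- mkℚᵘ (+ c) t)
  lhs≃ : toℚᵘ (fromℕℚ x ℚ.* ((1ℚ ℚ.+ 1ℚ) ℚ.- + a / suc b ℚ.- + c / suc t)) ℚᵘ.≃ L
  lhs≃ = ℚᵘP.≃-trans (ℚP.toℚᵘ-homo-* (fromℕℚ x) _) (ℚᵘP.*-cong (ℚP.toℚᵘ-fromℚᵘ (mkℚᵘ (+ x) 0))
           (minus (minus (ℚP.toℚᵘ-homo-+ 1ℚ 1ℚ) (ℚP.toℚᵘ-fromℚᵘ (mkℚᵘ (+ a) b))) (ℚP.toℚᵘ-fromℚᵘ (mkℚᵘ (+ c) t))))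
    where
    minus : ∀ {p q u v} → toℚᵘ p ℚᵘ.≃ u → toℚᵘ q ℚᵘ.≃ v → toℚᵘ (p ℚ.- q) ℚᵘ.≃ (u ℚᵘ.- v)
    minus {p} {q} p≃u q≃v = ℚᵘP.≃-trans (ℚP.toℚᵘ-homo-+ p (ℚ.- q))
                              (ℚᵘP.+-cong p≃u (ℚᵘP.≃-trans (ℚP.toℚᵘ-homo‿- q) (ℚᵘP.-‿cong q≃v)))
  cross : ↥ L ℤ.* ↧ mkℚᵘ (+ w) 0 ℤ.≤ + w ℤ.* ↧ L
  cross = begin
    ↥ L ℤ.* + 1                                        ≡⟨ numerator (+ x) (+ a) (+ c) B T ⟩
    + 2 ℤ.* (B ℤ.* T) ℤ.* + x ℤ.- Q                    ≤⟨ ℤP.+-monoˡ-≤ (ℤ.- Q) (subst₂ ℤ._≤_ lhs-cast rhs-cast (ℤ.+≤+ le)) ⟩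
    + w ℤ.* (B ℤ.* T) ℤ.+ Q ℤ.- Q                      ≡⟨ denominator (+ w) Q B T ⟩
    + w ℤ.* ↧ L                                        ∎
    where
    open ℤP.≤-Reasoning
    B = + suc b
    T = + suc t
    Q = + x ℤ.* (+ a ℤ.* T ℤ.+ + c ℤ.* B)
    -- left-hand side: ↥ L exactly as ℚᵘ arithmetic unfolds it
    numerator : ∀ X A C B T →
      X ℤ.* (((+ 2 ℤ.* B ℤ.+ ℤ.- A ℤ.* + 1) ℤ.* T) ℤ.+ ℤ.- C ℤ.* (+ 1 ℤ.* B)) ℤ.* + 1
      ≡ + 2 ℤ.* (B ℤ.* T) ℤ.* X ℤ.- X ℤ.* (A ℤ.* T ℤ.+ C ℤ.* B)
    numerator = ℤ-Solver.solve-∀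
    denominator : ∀ W Q B T → W ℤ.* (B ℤ.* T) ℤ.+ Q ℤ.- Q ≡ W ℤ.* (+ 1 ℤ.* ((+ 1 ℤ.* B) ℤ.* T))
    denominator = ℤ-Solver.solve-∀
    lhs-cast : + (2 * (suc b * suc t) * x) ≡ + 2 ℤ.* (B ℤ.* T) ℤ.* + x
    lhs-cast = ℤP.pos-* (2 * (suc b * suc t)) x
    rhs-cast : + (w * (suc b * suc t) + x * (a * suc t + c * suc b)) ≡ + w ℤ.* (B ℤ.* T) ℤ.+ Q
    rhs-cast = trans (ℤP.pos-+ (w * (suc b * suc t)) _)
      (cong₂ ℤ._+_ (ℤP.pos-* w _) (trans (ℤP.pos-* x _)
        (cong (+ x ℤ.*_) (trans (ℤP.pos-+ (a * suc t) _) (cong₂ ℤ._+_ (ℤP.pos-* a _) (ℤP.pos-* c _))))))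

ε : ℕ → ℚ
ε n = + 6 / suc (isqrt (2 * (n ∸ 1)))

6/[1+s]≤ : ∀ s p q .{c : Coprime (suc p) (suc q)} → 6 * suc q ≤ s → + 6 / suc s ℚ.≤ mkℚ (+ suc p) q c
6/[1+s]≤ s p q 6[1+q]≤s = ℚP.toℚᵘ-cancel-≤ (ℚᵘP.≤-respˡ-≃ (ℚᵘP.≃-sym (ℚP.toℚᵘ-fromℚᵘ (mkℚᵘ (+ 6) s)))
  (*≤* (subst₂ ℤ._≤_ (ℤP.pos-* 6 (suc q)) (ℤP.pos-* (suc p) (suc s))
         (ℤ.+≤+ (≤-trans 6[1+q]≤s (≤-trans (n≤1+n s) (m≤n*m (suc s) (suc p))))))))

ε→0 : ∀ δ → 0ℚ ℚ.< δ → ∃ λ N → ∀ n → N ≤ n → ∣ ε n ∣ ℚ.≤ δ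
ε→0 (mkℚ (+ zero) _ _) 0<δ with () ← positive 0<δ
ε→0 (mkℚ -[1+ _ ] _ _) 0<δ with () ← positive 0<δ
ε→0 (mkℚ (+ suc p) q c) _ = suc (B * B) , λ n N≤n →
  subst (ℚ._≤ mkℚ (+ suc p) q c) (sym (ℚP.0≤p⇒∣p∣≡p (ε-nonNegative n)))
    (6/[1+s]≤ _ p q (≤-isqrt (≤-trans (∸-monoˡ-≤ 1 N≤n) (m≤m+n (n ∸ 1) _))))
  where
  B = 6 * suc q
  ε-nonNegative : ∀ n → 0ℚ ℚ.≤ ε n
  ε-nonNegative n = ℚP.nonNegative⁻¹ (ε n) {{ℚP.normalize-nonNeg 6 (suc (isqrt (2 * (n ∸ 1))))}}

lemma3 : ∀ (d D : ℕ) → 2 ≤ d → d ≤ D → (hD : 3 ≤ D) →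
    Σ (ℕ → ℚ) (λ ε →
      (∀ (δ : ℚ) → 0ℚ ℚ.< δ → ∃ (λ N → ∀ n → N ≤ n → ∣ ε n ∣ ℚ.≤ δ)) ×
      (∀ (k : ℕ) → 1 ≤ k → (T : SpanningTree (D ∸ 1) k) → MaxDegreeAtMost T d →
        fromℕℚ (numVertices (D ∸ 1) k ∸ 1)
          ℚ.* ((1ℚ ℚ.+ 1ℚ) ℚ.- fracD (d ∸ 2) D hD ℚ.- ε (numVertices (D ∸ 1) k))
          ℚ.≤ fromℕℚ (weight T)))
lemma3 d (suc (suc (suc j))) 2≤d _ (s≤s (s≤s (s≤s _))) = ε , ε→0 , bound
  where
  bound : ∀ k → 1 ≤ k → (T : SpanningTree (suc (suc j)) k) → MaxDegreeAtMost T d →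
          fromℕℚ (numVertices (suc (suc j)) k ∸ 1) ℚ.* ((1ℚ ℚ.+ 1ℚ) ℚ.- + (d ∸ 2) / suc j ℚ.- ε (numVertices (suc (suc j)) k))
          ℚ.≤ fromℕℚ (weight T)
  bound k _ T deg≤d = two-minus-fractions-≤ X (weight T) (d ∸ 2) j 6 s
    (cleared-bound (suc j) (d ∸ 2) C k (weight T) s X weight≥ X≡ (proj₁ (isqrt-spec (2 * X))) (≤-isqrt (k²≤2[n∸1] j k)))
    where
    C = cumulativeNumVertices (suc (suc j)) k
    X = numVertices (suc (suc j)) k ∸ 1
    s = isqrt (2 * X)
    X≡ : X ≡ suc j * C + k
    X≡ = cong (_∸ 1) (numVertices-closed (suc j) k)
    weight≥ : (suc (suc j) + suc (suc j)) * C ≤ weight T + (d ∸ 2 + 2) * C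
    weight≥ = subst (λ d′ → _ ≤ weight T + d′ * C) (sym (m∸n+n≡m 2≤d)) (weight-≥ T d deg≤d)
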